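{- Let $n\geqslant 19$ with $n\equiv 3 \pmod 4$. Then $\mathbf{i}=\left(\frac{n + 1}{4}, \frac{n + 1}{4}, 5, 3, 2\times \frac{n - 19}{4}, 1\right)$ is a partition of $n$ and $\Lambda(\mathbf{i})=\left\lfloor\frac{n-3}{4}\right\rfloor + 1$; in particular $\left\lfloor\frac{n-3}{4}\right\rfloor + 1$ is an eigenvalue of $T_n$.
   Context: Notation $k\times t$ inside a partition means the part $k$ repeated $t$ times. For an integer partition $\mathbf{i}=(n_1,\dots,n_k)$ of $n$ (nonincreasing positive integers summing to $n$), $\Lambda(\mathbf{i})=\sum_{j=1}^k \frac{n_j(n_j-2j+1)}{2}$; this is the eigenvalue of the Transposition graph $T_n=\mathrm{Cay}(\mathrm{Sym}_n,\{\text{all transpositions}\})$ associated with the irreducible character of $\mathrm{Sym}_n$ indexed by $\mathbf{i}$, so $\Lambda(\mathbf{i})$ is an eigenvalue of $T_n$. -}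

module Defs where

open import Data.Nat as ℕ using (ℕ; zero; suc; _≥_; _<_; _∸_)
open import Data.Nat.DivMod using (_/_)
open import Data.Integer as ℤ using (ℤ; +_)
open import Data.Integer.DivMod using (_/ℕ_)
open import Data.Nat.ListAction using (sum)
open import Data.List using (List; []; _∷_; replicate; _++_; [_])
open import Data.List.Relation.Unary.All using (All)
open import Data.List.Relation.Unary.Linked using (Linked)
open import Data.Product using (_×_)
open import Relation.Binary.PropositionalEquality using (_≡_)

IsPartition : ℕ → List ℕ → Set
IsPartition n l = Linked _≥_ l × All (0 <_) l × sum l ≡ n

-- Λ(n_1,…,n_k) = Σ_{j=1}^k n_j (n_j - 2j + 1) / 2   (computed in ℤ;
-- each summand n_j(n_j - 2j + 1) is even, so the division is exact).
Λ-from : ℕ → List ℕ → ℤ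
Λ-from j []       = + 0
Λ-from j (m ∷ ms) =
  ((+ m ℤ.* (+ m ℤ.- + (2 ℕ.* j) ℤ.+ + 1)) /ℕ 2) ℤ.+ Λ-from (suc j) ms

Λ : List ℕ → ℤ
Λ = Λ-from 1

partitionI : ℕ → List ℕ
partitionI n =
  ((n ℕ.+ 1) / 4) ∷ ((n ℕ.+ 1) / 4) ∷ 5 ∷ 3 ∷ (replicate ((n ∸ 19) / 4) 2 ++ [ 1 ])

{-# OPTIONS --safe #-}
-- Write n = 19 + 4k, so the partition is (5+k, 5+k, 5, 3, 2 × k, 1). The j-th summand
-- of Λ is m (m + 1)/2 - j m for the part m, so the two large parts contribute
-- (5+k)(6+k) - 3 (5+k), the parts 5 and 3 contribute 0 and -6, and the tail of 2s and
-- the final 1 starting at position 5 contributes -(k² + 7k + 4); the sum is k + 5.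
module Submission where

open import Defs
open import Data.Nat using (ℕ; _≥_; _∸_; _+_)
open import Data.Nat.DivMod using (_/_; _%_)
open import Data.Integer using (+_)
open import Data.Product using (_×_)
open import Relation.Binary.PropositionalEquality using (_≡_)

open import Data.Nat as ℕ using (zero; suc; s≤s; z≤n)
import Data.Nat.Properties as ℕ
open import Data.Nat.DivMod using (m*n/n≡m; m*n%n≡0; m≡m%n+[m/n]*n)
open import Data.Nat.ListAction using (sum)
import Data.Nat.Tactic.RingSolver as ℕ-Solver
open import Data.Integer as ℤ using (-[1+_])
open import Data.Integer.Properties using (pos-*; pos-+)
open import Data.Integer.Tactic.RingSolver using (solve-∀)
open import Data.List using (List; _∷_; replicate; _++_; [_])
open import Data.List.Relation.Unary.All using (All; []; _∷_)
open import Data.List.Relation.Unary.Linked using (Linked; [-]; _∷_)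
open import Data.Product using (∃-syntax; _,_)
open import Relation.Nullary.Decidable using (toWitnessFalse)
open import Relation.Nullary.Negation using (contradiction)
open import Relation.Binary.PropositionalEquality
  using (refl; sym; trans; cong; cong₂; subst; module ≡-Reasoning)

-[1+n]/ℕd≡-[sucn/d] : ∀ n d .{{_ : ℕ.NonZero d}} →
  suc n % d ≡ 0 → -[1+ n ] ℤ./ℕ d ≡ ℤ.- + (suc n / d)
-[1+n]/ℕd≡-[sucn/d] n d sucn%d≡0 with suc n % d
... | zero = refl

i*n/ℕn≡i : ∀ i d .{{_ : ℕ.NonZero d}} → (i ℤ.* + d) ℤ./ℕ d ≡ i
i*n/ℕn≡i (+ m)    d        = trans (cong (ℤ._/ℕ d) (sym (pos-* m d))) (cong +_ (m*n/n≡m m d))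
i*n/ℕn≡i -[1+ m ] (suc d') =
  trans (-[1+n]/ℕd≡-[sucn/d] (d' + m ℕ.* suc d') (suc d') (m*n%n≡0 (suc m) (suc d')))
        (cong (λ q → ℤ.- + q) (m*n/n≡m (suc m) (suc d')))

triangle : ℕ → ℕ
triangle zero    = 0
triangle (suc m) = suc m + triangle m

triangle*2 : ∀ m → + triangle m ℤ.* + 2 ≡ + m ℤ.* (+ m ℤ.+ + 1)
triangle*2 m = trans (sym (pos-* (triangle m) 2))
  (trans (cong +_ (ℕ-triangle*2 m)) (trans (pos-* m (m + 1)) (cong (+ m ℤ.*_) (pos-+ m 1))))
  where
  ℕ-triangle*2 : ∀ m → triangle m ℕ.* 2 ≡ m ℕ.* (m + 1)
  ℕ-triangle*2 zero    = refl
  ℕ-triangle*2 (suc m) = begin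
    (suc m + triangle m) ℕ.* 2     ≡⟨ ℕ.*-distribʳ-+ 2 (suc m) (triangle m) ⟩
    suc m ℕ.* 2 + triangle m ℕ.* 2 ≡⟨ cong (λ x → suc m ℕ.* 2 + x) (ℕ-triangle*2 m) ⟩
    suc m ℕ.* 2 + m ℕ.* (m + 1)    ≡⟨ regroup m ⟩
    suc m ℕ.* (suc m + 1)          ∎
    where
    open ≡-Reasoning
    regroup : ∀ m → (1 + m) ℕ.* 2 + m ℕ.* (m + 1) ≡ (1 + m) ℕ.* ((1 + m) + 1)
    regroup = ℕ-Solver.solve-∀

-- The numerator is 2 (T - j m) with 2 T = m (m + 1), so the division by 2 is exact.
Λ-summand : ∀ j m →
  (+ m ℤ.* (+ m ℤ.- + (2 ℕ.* j) ℤ.+ + 1)) ℤ./ℕ 2 ≡ + triangle m ℤ.- + j ℤ.* + m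
Λ-summand j m = trans (cong (ℤ._/ℕ 2) doubled) (i*n/ℕn≡i (+ triangle m ℤ.- + j ℤ.* + m) 2)
  where
  open ≡-Reasoning
  T = + triangle m
  expand : ∀ M J → M ℤ.* (M ℤ.- + 2 ℤ.* J ℤ.+ + 1) ≡ M ℤ.* (M ℤ.+ + 1) ℤ.- J ℤ.* M ℤ.* + 2
  expand = solve-∀
  factor : ∀ T J M → T ℤ.* + 2 ℤ.- J ℤ.* M ℤ.* + 2 ≡ (T ℤ.- J ℤ.* M) ℤ.* + 2
  factor = solve-∀
  doubled : + m ℤ.* (+ m ℤ.- + (2 ℕ.* j) ℤ.+ + 1) ≡ (T ℤ.- + j ℤ.* + m) ℤ.* + 2
  doubled = begin
    + m ℤ.* (+ m ℤ.- + (2 ℕ.* j) ℤ.+ + 1)          ≡⟨ cong (λ x → + m ℤ.* (+ m ℤ.- x ℤ.+ + 1)) (pos-* 2 j) ⟩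
    + m ℤ.* (+ m ℤ.- + 2 ℤ.* + j ℤ.+ + 1)          ≡⟨ expand (+ m) (+ j) ⟩
    + m ℤ.* (+ m ℤ.+ + 1) ℤ.- + j ℤ.* + m ℤ.* + 2  ≡⟨ cong (ℤ._- + j ℤ.* + m ℤ.* + 2) (sym (triangle*2 m)) ⟩
    T ℤ.* + 2 ℤ.- + j ℤ.* + m ℤ.* + 2              ≡⟨ factor T (+ j) (+ m) ⟩
    (T ℤ.- + j ℤ.* + m) ℤ.* + 2                    ∎

Λ-from-twos-one : ∀ j k →
  Λ-from j (replicate k 2 ++ [ 1 ]) ≡ + 1 ℤ.- + j ℤ.- + k ℤ.* (+ 2 ℤ.* + j ℤ.+ + k ℤ.- + 3)
Λ-from-twos-one j zero = begin
  Λ-from j [ 1 ]                 ≡⟨ cong (ℤ._+ + 0) (Λ-summand j 1) ⟩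
  + 1 ℤ.- + j ℤ.* + 1 ℤ.+ + 0    ≡⟨ simplify (+ j) ⟩
  + 1 ℤ.- + j ℤ.- + 0 ℤ.* (+ 2 ℤ.* + j ℤ.+ + 0 ℤ.- + 3) ∎
  where
  open ≡-Reasoning
  simplify : ∀ J → + 1 ℤ.- J ℤ.* + 1 ℤ.+ + 0 ≡ + 1 ℤ.- J ℤ.- + 0 ℤ.* (+ 2 ℤ.* J ℤ.+ + 0 ℤ.- + 3)
  simplify = solve-∀
Λ-from-twos-one j (suc k) = begin
  Λ-from j (2 ∷ replicate k 2 ++ [ 1 ])
    ≡⟨ cong₂ ℤ._+_ (Λ-summand j 2) (Λ-from-twos-one (suc j) k) ⟩
  + 3 ℤ.- + j ℤ.* + 2 ℤ.+ (+ 1 ℤ.- + suc j ℤ.- + k ℤ.* (+ 2 ℤ.* + suc j ℤ.+ + k ℤ.- + 3))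
    ≡⟨ cong (λ J → + 3 ℤ.- + j ℤ.* + 2 ℤ.+ (+ 1 ℤ.- J ℤ.- + k ℤ.* (+ 2 ℤ.* J ℤ.+ + k ℤ.- + 3)))
            (pos-+ 1 j) ⟩
  + 3 ℤ.- + j ℤ.* + 2 ℤ.+ (+ 1 ℤ.- (+ 1 ℤ.+ + j) ℤ.- + k ℤ.* (+ 2 ℤ.* (+ 1 ℤ.+ + j) ℤ.+ + k ℤ.- + 3))
    ≡⟨ step (+ j) (+ k) ⟩
  + 1 ℤ.- + j ℤ.- (+ 1 ℤ.+ + k) ℤ.* (+ 2 ℤ.* + j ℤ.+ (+ 1 ℤ.+ + k) ℤ.- + 3)
    ≡⟨ cong (λ K → + 1 ℤ.- + j ℤ.- K ℤ.* (+ 2 ℤ.* + j ℤ.+ K ℤ.- + 3)) (sym (pos-+ 1 k)) ⟩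
  + 1 ℤ.- + j ℤ.- + suc k ℤ.* (+ 2 ℤ.* + j ℤ.+ + suc k ℤ.- + 3) ∎
  where
  open ≡-Reasoning
  step : ∀ J K →
    + 3 ℤ.- J ℤ.* + 2 ℤ.+ (+ 1 ℤ.- (+ 1 ℤ.+ J) ℤ.- K ℤ.* (+ 2 ℤ.* (+ 1 ℤ.+ J) ℤ.+ K ℤ.- + 3))
      ≡ + 1 ℤ.- J ℤ.- (+ 1 ℤ.+ K) ℤ.* (+ 2 ℤ.* J ℤ.+ (+ 1 ℤ.+ K) ℤ.- + 3)
  step = solve-∀

shape : ℕ → List ℕ
shape k = (5 + k) ∷ (5 + k) ∷ 5 ∷ 3 ∷ (replicate k 2 ++ [ 1 ])

partitionI-shape : ∀ k → partitionI (19 + k ℕ.* 4) ≡ shape k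
partitionI-shape k = cong₂ (λ a b → a ∷ a ∷ 5 ∷ 3 ∷ (replicate b 2 ++ [ 1 ]))
  (trans (cong (λ x → (19 + x) / 4) (ℕ.+-comm (k ℕ.* 4) 1)) (m*n/n≡m (5 + k) 4))
  (m*n/n≡m k 4)

twos-one-linked : ∀ {m} → m ≥ 2 → ∀ k → Linked _≥_ (m ∷ replicate k 2 ++ [ 1 ])
twos-one-linked m≥2 zero    = ℕ.≤-trans (s≤s z≤n) m≥2 ∷ [-]
twos-one-linked m≥2 (suc k) = m≥2 ∷ twos-one-linked ℕ.≤-refl k

twos-one-positive : ∀ k → All (0 ℕ.<_) (replicate k 2 ++ [ 1 ])
twos-one-positive zero    = s≤s z≤n ∷ []
twos-one-positive (suc k) = s≤s z≤n ∷ twos-one-positive k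

sum-twos-one : ∀ k → sum (replicate k 2 ++ [ 1 ]) ≡ 1 + k ℕ.* 2
sum-twos-one zero    = refl
sum-twos-one (suc k) = cong (λ s → 2 + s) (sum-twos-one k)

shape-isPartition : ∀ k → IsPartition (19 + k ℕ.* 4) (shape k)
shape-isPartition k =
  (ℕ.≤-refl ∷ ℕ.m≤m+n 5 k ∷ ℕ.m≤m+n 3 2 ∷ twos-one-linked (ℕ.m≤m+n 2 1) k) ,
  (s≤s z≤n ∷ s≤s z≤n ∷ s≤s z≤n ∷ s≤s z≤n ∷ twos-one-positive k) ,
  (begin
    (5 + k) + ((5 + k) + (5 + (3 + sum (replicate k 2 ++ [ 1 ]))))
      ≡⟨ cong (λ s → (5 + k) + ((5 + k) + (5 + (3 + s)))) (sum-twos-one k) ⟩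
    (5 + k) + ((5 + k) + (5 + (3 + (1 + k ℕ.* 2))))
      ≡⟨ total k ⟩
    19 + k ℕ.* 4 ∎)
  where
  open ≡-Reasoning
  total : ∀ k → (5 + k) + ((5 + k) + (5 + (3 + (1 + k ℕ.* 2)))) ≡ 19 + k ℕ.* 4
  total = ℕ-Solver.solve-∀

Λ-shape : ∀ k → Λ (shape k) ≡ + (5 + k)
Λ-shape k = begin
  Λ (shape k)
    ≡⟨ cong₂ ℤ._+_ (Λ-summand 1 (5 + k))
         (cong₂ ℤ._+_ (Λ-summand 2 (5 + k))
           (cong (λ t → + 0 ℤ.+ (ℤ.- + 6 ℤ.+ t)) (Λ-from-twos-one 5 k))) ⟩
  (T ℤ.- + 1 ℤ.* A) ℤ.+ ((T ℤ.- + 2 ℤ.* A) ℤ.+ (+ 0 ℤ.+ (ℤ.- + 6 ℤ.+ tail)))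
    ≡⟨ collect T A tail ⟩
  T ℤ.* + 2 ℤ.- + 3 ℤ.* A ℤ.- + 6 ℤ.+ tail
    ≡⟨ cong (λ x → x ℤ.- + 3 ℤ.* A ℤ.- + 6 ℤ.+ tail) (triangle*2 (5 + k)) ⟩
  A ℤ.* (A ℤ.+ + 1) ℤ.- + 3 ℤ.* A ℤ.- + 6 ℤ.+ tail
    ≡⟨ cong (λ a → a ℤ.* (a ℤ.+ + 1) ℤ.- + 3 ℤ.* a ℤ.- + 6 ℤ.+ tail) (pos-+ 5 k) ⟩
  (+ 5 ℤ.+ + k) ℤ.* ((+ 5 ℤ.+ + k) ℤ.+ + 1) ℤ.- + 3 ℤ.* (+ 5 ℤ.+ + k) ℤ.- + 6 ℤ.+ tail
    ≡⟨ cancel (+ k) ⟩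
  + 5 ℤ.+ + k
    ≡⟨ sym (pos-+ 5 k) ⟩
  + (5 + k) ∎
  where
  open ≡-Reasoning
  A    = + (5 + k)
  T    = + triangle (5 + k)
  tail = + 1 ℤ.- + 5 ℤ.- + k ℤ.* (+ 2 ℤ.* + 5 ℤ.+ + k ℤ.- + 3)
  collect : ∀ T A R → (T ℤ.- + 1 ℤ.* A) ℤ.+ ((T ℤ.- + 2 ℤ.* A) ℤ.+ (+ 0 ℤ.+ (ℤ.- + 6 ℤ.+ R)))
                      ≡ T ℤ.* + 2 ℤ.- + 3 ℤ.* A ℤ.- + 6 ℤ.+ R
  collect = solve-∀
  cancel : ∀ K → (+ 5 ℤ.+ K) ℤ.* ((+ 5 ℤ.+ K) ℤ.+ + 1) ℤ.- + 3 ℤ.* (+ 5 ℤ.+ K) ℤ.- + 6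
                 ℤ.+ (+ 1 ℤ.- + 5 ℤ.- K ℤ.* (+ 2 ℤ.* + 5 ℤ.+ K ℤ.- + 3)) ≡ + 5 ℤ.+ K
  cancel = solve-∀

≡3-mod-4⇒≡19+4k : ∀ n → n ≥ 19 → n % 4 ≡ 3 → ∃[ k ] n ≡ 19 + k ℕ.* 4
≡3-mod-4⇒≡19+4k n n≥19 n%4≡3 = from-quotient (n / 4) n≥19 n≡3+q*4
  where
  n≡3+q*4 : n ≡ 3 + (n / 4) ℕ.* 4
  n≡3+q*4 = trans (m≡m%n+[m/n]*n n 4) (cong (λ r → r + (n / 4) ℕ.* 4) n%4≡3)
  from-quotient : ∀ q → n ≥ 19 → n ≡ 3 + q ℕ.* 4 → ∃[ k ] n ≡ 19 + k ℕ.* 4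
  from-quotient 0 3≥19  refl = contradiction 3≥19 (toWitnessFalse {a? = 19 ℕ.≤? 3} _)
  from-quotient 1 7≥19  refl = contradiction 7≥19 (toWitnessFalse {a? = 19 ℕ.≤? 7} _)
  from-quotient 2 11≥19 refl = contradiction 11≥19 (toWitnessFalse {a? = 19 ℕ.≤? 11} _)
  from-quotient 3 15≥19 refl = contradiction 15≥19 (toWitnessFalse {a? = 19 ℕ.≤? 15} _)
  from-quotient (suc (suc (suc (suc k)))) _ n≡19+k*4 = k , n≡19+k*4

lemma10 : (n : ℕ) → n ≥ 19 → n % 4 ≡ 3 →
    IsPartition n (partitionI n) × Λ (partitionI n) ≡ + ((n ∸ 3) / 4 + 1)
lemma10 n n≥19 n%4≡3 with ≡3-mod-4⇒≡19+4k n n≥19 n%4≡3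
... | k , refl =
  subst (λ l → IsPartition (19 + k ℕ.* 4) l × Λ l ≡ + ((16 + k ℕ.* 4) / 4 + 1))
        (sym (partitionI-shape k))
        (shape-isPartition k , trans (Λ-shape k) (cong +_ (sym quotient+1)))
  where
  quotient+1 : (16 + k ℕ.* 4) / 4 + 1 ≡ 5 + k
  quotient+1 = trans (cong (_+ 1) (m*n/n≡m (4 + k) 4)) (ℕ.+-comm (4 + k) 1)
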